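{- Let $M \geq 1$ and $A \geq 0$ be integers, and let $f$ be an $(M,A)$-quasi-isometry from a graph $G$ to a graph $H$. Let $W \subseteq V(H)$ induce a connected subgraph of $H$, and for every $w \in W$ let $u_w$ be a vertex of $G$ with $d_H(f(u_w), w) \leq A$. Let $U := \{u_w : w \in W\}$. Then $B_G(U, M(3A+1))$ induces a connected subgraph of $G$.
   Context: $d_G$ denotes graph distance. For a set $U$ of vertices of a graph $G$ and $r \geq 0$, $B_G(U,r)$ is the set of vertices of $G$ at distance at most $r$ from $U$. For integers $M \geq 1$, $A \geq 0$, an $(M,A)$-quasi-isometry from $G$ to $H$ is a map $f: V(G) \to V(H)$ such that $M^{ -1} d_G(u,v) - A \leq d_H(f(u),f(v)) \leq M d_G(u,v) + A$ for all $u,v \in V(G)$, and every vertex of $H$ is at distance at most $A$ from some vertex $f(v)$, $v \in V(G)$. -}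

module Defs where

open import Data.Nat using (ℕ; zero; suc; _+_; _*_; _≤_)
open import Data.Product using (Σ; ∃; _×_; _,_)
open import Data.Empty using (⊥)
open import Relation.Binary.PropositionalEquality using (_≡_)

record Graph : Set₁ where
  field
    V     : Set
    Adj   : V → V → Set
    sym   : ∀ {x y} → Adj x y → Adj y x
    irrefl : ∀ {x} → Adj x x → ⊥
open Graph public

data Walk (G : Graph) : V G → V G → ℕ → Set where
  here  : ∀ {x} → Walk G x x zero
  step  : ∀ {x y z n} → Adj G x y → Walk G y z n → Walk G x z (suc n)

data WalkIn (G : Graph) (S : V G → Set) : V G → V G → Set where
  here  : ∀ {x} → S x → WalkIn G S x x
  step  : ∀ {x y z} → S x → Adj G x y → WalkIn G S y z → WalkIn G S x z

-- d_G(x,y) ≤ k : there is a walk from x to y of length at most k.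
-- (d_G(x,y) = ∞ when no walk exists; then this never holds.)
DistLe : (G : Graph) → V G → V G → ℕ → Set
DistLe G x y k = Σ ℕ λ n → n ≤ k × Walk G x y n

InducesConnected : (G : Graph) → (V G → Set) → Set
InducesConnected G S = ∀ x y → S x → S y → WalkIn G S x y

Ball : (G : Graph) → (V G → Set) → ℕ → V G → Set
Ball G U r x = Σ (V G) λ u → U u × DistLe G u x r

-- (M,A)-quasi-isometry f : G → H.
--  M⁻¹ d_G(u,v) − A ≤ d_H(f u,f v)   ⇔  d_G(u,v) ≤ M (d_H(f u,f v) + A)
--  d_H(f u,f v) ≤ M d_G(u,v) + A
record IsQuasiIsometry (M A : ℕ) (G H : Graph) (f : V G → V H) : Set where
  field
    lower : ∀ u v k → DistLe H (f u) (f v) k → DistLe G u v (M * (k + A))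
    upper : ∀ u v k → DistLe G u v k → DistLe H (f u) (f v) (M * k + A)
    dense : ∀ y → Σ (V G) λ v → DistLe H (f v) y A

{-# OPTIONS --safe #-}
module Submission where

-- If a, b are adjacent in W, then f(u a) and f(u b) are at distance at most
-- A + 1 + A in H, so the lower quasi-isometry bound puts u a and u b at distance
-- at most M (3A + 1) in G, and a shortest walk between them stays in the ball
-- around u a. Following a path of W therefore joins any two centres inside the
-- ball, and every point of the ball is joined to its centre by a walk inside it.

open import Defs
open import Data.Nat using (ℕ; suc; _+_; _*_; _≤_; z≤n)
open import Data.Nat.Properties using (≤-trans; ≤-reflexive; +-mono-≤)
open import Data.Nat.Solver using (module +-*-Solver)
open import Data.Product using (Σ; _×_; _,_)
open import Relation.Binary.PropositionalEquality using (_≡_; refl; cong)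

module _ {G : Graph} where

  walk-snoc : ∀ {x y z n} → Walk G x y n → Adj G y z → Walk G x z (suc n)
  walk-snoc here         e = step e here
  walk-snoc (step e′ w) e = step e′ (walk-snoc w e)

  walk-reverse : ∀ {x y n} → Walk G x y n → Walk G y x n
  walk-reverse here       = here
  walk-reverse (step e w) = walk-snoc (walk-reverse w) (Graph.sym G e)

  walk-append : ∀ {x y z m n} → Walk G x y m → Walk G y z n → Walk G x z (m + n)
  walk-append here       v = v
  walk-append (step e w) v = step e (walk-append w v)

  DistLe-refl : ∀ {x} → DistLe G x x 0
  DistLe-refl = 0 , z≤n , here

  DistLe-adj : ∀ {x y} → Adj G x y → DistLe G x y 1
  DistLe-adj e = 1 , ≤-reflexive refl , step e here

  DistLe-weaken : ∀ {x y k l} → k ≤ l → DistLe G x y k → DistLe G x y l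
  DistLe-weaken k≤l (n , n≤k , w) = n , ≤-trans n≤k k≤l , w

  DistLe-sym : ∀ {x y k} → DistLe G x y k → DistLe G y x k
  DistLe-sym (n , n≤k , w) = n , n≤k , walk-reverse w

  DistLe-trans : ∀ {x y z k l} → DistLe G x y k → DistLe G y z l → DistLe G x z (k + l)
  DistLe-trans (m , m≤k , v) (n , n≤l , w) = m + n , +-mono-≤ m≤k n≤l , walk-append v w

module _ {G : Graph} {S : V G → Set} where

  walkIn-head : ∀ {x y} → WalkIn G S x y → S x
  walkIn-head (here sx)     = sx
  walkIn-head (step sx _ _) = sx

  walkIn-snoc : ∀ {x y z} → WalkIn G S x y → Adj G y z → S z → WalkIn G S x z
  walkIn-snoc (here sy)       e sz = step sy e (here sz)
  walkIn-snoc (step sx e′ w) e sz = step sx e′ (walkIn-snoc w e sz)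

  walkIn-reverse : ∀ {x y} → WalkIn G S x y → WalkIn G S y x
  walkIn-reverse (here sx)     = here sx
  walkIn-reverse (step sx e w) = walkIn-snoc (walkIn-reverse w) (Graph.sym G e) sx

  walkIn-append : ∀ {x y z} → WalkIn G S x y → WalkIn G S y z → WalkIn G S x z
  walkIn-append (here _)      v = v
  walkIn-append (step sx e w) v = step sx e (walkIn-append w v)

walkIn-map : ∀ {G : Graph} {S T : V G → Set} → (∀ {x} → S x → T x) →
             ∀ {x y} → WalkIn G S x y → WalkIn G T x y
walkIn-map S⊆T (here sx)     = here (S⊆T sx)
walkIn-map S⊆T (step sx e w) = step (S⊆T sx) e (walkIn-map S⊆T w)

walkIn-image : ∀ {G H : Graph} {S : V H → Set} {T : V G → Set} (g : V H → V G) →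
               (∀ {a} → S a → T (g a)) →
               (∀ {a b} → S a → Adj H a b → S b → WalkIn G T (g a) (g b)) →
               ∀ {a b} → WalkIn H S a b → WalkIn G T (g a) (g b)
walkIn-image g maps-to joins (here sa)     = here (maps-to sa)
walkIn-image g maps-to joins (step sa e w) =
  walkIn-append (joins sa e (walkIn-head w)) (walkIn-image g maps-to joins w)

walk-within-length : ∀ {G : Graph} {x z n} → Walk G x z n → WalkIn G (λ v → DistLe G x v n) x z
walk-within-length here       = here DistLe-refl
walk-within-length (step e w) =
  step (DistLe-weaken z≤n DistLe-refl) e (walkIn-map (DistLe-trans (DistLe-adj e)) (walk-within-length w))

module _ {G : Graph} {U : V G → Set} {r : ℕ} where

  DistLe⇒walkIn-Ball : ∀ {u z} → U u → DistLe G u z r → WalkIn G (Ball G U r) u z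
  DistLe⇒walkIn-Ball {u} Uu (n , n≤r , w) =
    walkIn-map (λ d → u , Uu , DistLe-weaken n≤r d) (walk-within-length w)

  Ball-connected : (∀ u v → U u → U v → WalkIn G (Ball G U r) u v) →
                   InducesConnected G (Ball G U r)
  Ball-connected joins x y (u , Uu , u~x) (v , Uv , v~y) =
    walkIn-append (walkIn-reverse (DistLe⇒walkIn-Ball Uu u~x))
      (walkIn-append (joins u v Uu Uv) (DistLe⇒walkIn-Ball Uv v~y))

quasiIsometry-near-adjacent : ∀ {M A G H f} → IsQuasiIsometry M A G H f →
  ∀ {x y a b} → DistLe H (f x) a A → Adj H a b → DistLe H (f y) b A →
  DistLe G x y (M * (3 * A + 1))
quasiIsometry-near-adjacent {M} {A} qi {x} {y} x~a e y~b =
  DistLe-weaken (≤-reflexive (cong (M *_) (arithmetic A)))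
    (IsQuasiIsometry.lower qi x y _ (DistLe-trans x~a (DistLe-trans (DistLe-adj e) (DistLe-sym y~b))))
  where
  open +-*-Solver
  arithmetic : ∀ A → A + (1 + A) + A ≡ 3 * A + 1
  arithmetic = solve 1 (λ a → a :+ (con 1 :+ a) :+ a := con 3 :* a :+ con 1) refl

lemma2p2 : (M A : ℕ) → 1 ≤ M → (G H : Graph) → (f : V G → V H) →
    IsQuasiIsometry M A G H f →
    (W : V H → Set) → InducesConnected H W →
    (u : V H → V G) → (∀ w → W w → DistLe H (f (u w)) w A) →
    InducesConnected G
      (Ball G (λ x → Σ (V H) λ w → W w × u w ≡ x) (M * (3 * A + 1)))
lemma2p2 M A _ G H f qi W W-connected u u-near =
  Ball-connected λ { _ _ (a , Wa , refl) (b , Wb , refl) →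
    walkIn-image u centre-in-Ball joins (W-connected a b Wa Wb) }
  where
  Centre : V G → Set
  Centre x = Σ (V H) λ w → W w × u w ≡ x

  centre-in-Ball : ∀ {a} → W a → Ball G Centre (M * (3 * A + 1)) (u a)
  centre-in-Ball {a} Wa = u a , (a , Wa , refl) , DistLe-weaken z≤n DistLe-refl

  joins : ∀ {a b} → W a → Adj H a b → W b → WalkIn G (Ball G Centre (M * (3 * A + 1))) (u a) (u b)
  joins {a} {b} Wa e Wb =
    DistLe⇒walkIn-Ball (a , Wa , refl) (quasiIsometry-near-adjacent qi (u-near a Wa) e (u-near b Wb))
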